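{- Let $G=G_1\oplus G_2$, let $R_1,\dots,R_n,W_1,\dots,W_m,H\in G_1$ and $X_1,\dots,X_{m+2}\in G_2$, with $R=(R_1,\dots,R_n)$, $W=(W_1,\dots,W_m)$, $X=(X_1,\dots,X_{m+2})$. Suppose $R_1\cdots R_n=1$. Then for every $j\in\{1,\dots,m\}$, $P_X(R,W,H)$ is Hurwitz equivalent to $P_X(R^{W_j},W,H)$, where $R^{W_j}=(R_1^{W_j},\dots,R_n^{W_j})$.
   Context: Conjugation notation: $a^b=b^{ -1}ab$. $P_X(R,W,H)$ denotes the factorization in $G_1\oplus G_2$ given by $((R_1,1),\dots,(R_n,1),(W_1,X_1),\dots,(W_m,X_m),(H^{ -1},X_{m+1}),(H,X_{m+2}))$. The braid group $B_k$ acts on the right on tuples of group elements by $(f_1,\dots,f_k)\sigma_i=(f_1,\dots,f_{i-1},f_{i+1},f_{i+1}^{ -1}f_if_{i+1},f_{i+2},\dots,f_k)$, $(f_1,\dots,f_k)\sigma_i^{ -1}=(f_1,\dots,f_{i-1},f_if_{i+1}f_i^{ -1},f_i,f_{i+2},\dots,f_k)$; Hurwitz equivalent means in the same orbit. -}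

module Defs where

open import Level using (Level; _⊔_)
open import Algebra using (Group)
open import Algebra.Construct.DirectProduct using (group)
open import Data.Nat using (ℕ; _+_)
open import Data.Product using (_,_)
open import Data.Sum using (_⊎_)
open import Data.List using (List; []; _∷_; _++_)
open import Data.List.Relation.Binary.Pointwise using (Pointwise)
open import Data.Vec using (Vec; toList; map; zipWith; take; drop; lookup)
open import Data.Fin using (Fin; zero; suc)
open import Relation.Binary.Construct.Closure.ReflexiveTransitive using (Star)

module _ {c ℓ : Level} (G : Group c ℓ) where
  open Group G

  conj : Carrier → Carrier → Carrier
  conj a b = (b ⁻¹ ∙ a) ∙ b

  prod : List Carrier → Carrier
  prod []       = ε
  prod (f ∷ fs) = f ∙ prod fs

  -- One elementary Hurwitz move: the action of some σ_i or σ_i⁻¹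
  -- (acting on positions i, i+1) on a tuple.
  data HurwitzStep : List Carrier → List Carrier → Set (c ⊔ ℓ) where
    σ     : ∀ {a b fs} → HurwitzStep (a ∷ b ∷ fs) (b ∷ ((b ⁻¹ ∙ a) ∙ b) ∷ fs)
    σ⁻¹   : ∀ {a b fs} → HurwitzStep (a ∷ b ∷ fs) (((a ∙ b) ∙ a ⁻¹) ∷ a ∷ fs)
    there : ∀ {f fs gs} → HurwitzStep fs gs → HurwitzStep (f ∷ fs) (f ∷ gs)

  -- Hurwitz equivalence: same orbit under the braid group action
  -- (finite sequences of moves σ_i^{±1}), up to the group's setoid equality.
  HurwitzEquiv : List Carrier → List Carrier → Set (c ⊔ ℓ)
  HurwitzEquiv = Star (λ fs gs → HurwitzStep fs gs ⊎ Pointwise _≈_ fs gs)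

module _ {c₁ ℓ₁ c₂ ℓ₂ : Level} (G₁ : Group c₁ ℓ₁) (G₂ : Group c₂ ℓ₂) where
  private
    module G₁ = Group G₁
    module G₂ = Group G₂

  P : {n m : ℕ} → Vec G₁.Carrier m → Vec G₂.Carrier (m + 2) → Vec G₁.Carrier n
    → G₁.Carrier → List (Group.Carrier (group G₁ G₂))
  P {n} {m} W X R H =
       toList (map (λ r → (r , G₂.ε)) R)
    ++ toList (zipWith _,_ W (take m X))
    ++ ((H G₁.⁻¹ , lookup (drop m X) zero) ∷ (H , lookup (drop m X) (suc zero)) ∷ [])

-- A block f of a factorization whose product is 1 commutes with every element: sweeping an
-- element g leftwards through f by σ⁻¹-moves turns g into (Π f) g (Π f)⁻¹ = g.  Hence the
-- block R can be moved to just before W_j, W_j can be swept leftwards through it by σ-moves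
-- (which conjugates every entry of R by W_j), and the block R^{W_j}, still of product 1, can
-- be moved back to the front.
module Submission where

open import Defs
open import Level using (Level)
open import Algebra using (Group)
open import Algebra.Construct.DirectProduct using (group)
open import Data.Nat using (ℕ; _+_)
open import Data.Fin using (Fin)
open import Data.Vec using (Vec; toList; map; lookup)

open import Data.Product using (∃; _×_; _,_)
open import Data.Sum using (inj₁; inj₂; _⊎_)
open import Data.List as List using (List; []; _∷_; _++_; [_])
open import Data.List.Properties using (++-assoc)
open import Data.List.Membership.Propositional using (_∈_)
open import Data.List.Membership.Propositional.Properties using (∈-∃++; ∈-++⁺ˡ)
open import Data.List.Relation.Binary.Pointwise as Pointwise using (Pointwise; []; _∷_)
import Data.Vec as Vec
open import Data.Vec.Properties using (lookup-zipWith)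
open import Data.Vec.Membership.Propositional.Properties using (∈-lookup; ∈-toList⁺)
open import Relation.Binary.Construct.Closure.ReflexiveTransitive as Star
  using (_◅_; _◅◅_)
open import Relation.Binary.PropositionalEquality as ≡ using (_≡_)

module Conjugation {c ℓ : Level} (G : Group c ℓ) where
  open Group G
  open import Algebra.Properties.Group G using (\\-leftDividesˡ)
  open import Relation.Binary.Reasoning.Setoid setoid

  _^_ : Carrier → Carrier → Carrier
  _^_ = conj G

  ^-congˡ : ∀ {a b} g → a ≈ b → a ^ g ≈ b ^ g
  ^-congˡ g a≈b = ∙-congʳ (∙-congˡ a≈b)

  ε^g≈ε : ∀ g → ε ^ g ≈ ε
  ε^g≈ε g = trans (∙-congʳ (identityʳ (g ⁻¹))) (inverseˡ g)

  prod-map-^ : ∀ f g → prod G (List.map (_^ g) f) ≈ prod G f ^ g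
  prod-map-^ []      g = sym (ε^g≈ε g)
  prod-map-^ (a ∷ f) g = begin
    (a ^ g) ∙ prod G (List.map (_^ g) f) ≈⟨ ∙-congˡ (prod-map-^ f g) ⟩
    ((g ⁻¹ ∙ a) ∙ g) ∙ ((g ⁻¹ ∙ p) ∙ g) ≈⟨ assoc _ _ _ ⟩
    (g ⁻¹ ∙ a) ∙ (g ∙ ((g ⁻¹ ∙ p) ∙ g)) ≈⟨ ∙-congˡ (assoc _ _ _) ⟨
    (g ⁻¹ ∙ a) ∙ ((g ∙ (g ⁻¹ ∙ p)) ∙ g) ≈⟨ ∙-congˡ (∙-congʳ (\\-leftDividesˡ g p)) ⟩
    (g ⁻¹ ∙ a) ∙ (p ∙ g)                ≈⟨ assoc _ _ _ ⟨
    ((g ⁻¹ ∙ a) ∙ p) ∙ g                ≈⟨ ∙-congʳ (assoc _ _ _) ⟩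
    (a ∙ p) ^ g                         ∎
    where
    p : Carrier
    p = prod G f

module HurwitzMoves {c ℓ : Level} (G : Group c ℓ) where
  open Group G
  open import Algebra.Properties.Group G
    using (\\-leftDividesˡ; \\-leftDividesʳ; //-rightDividesˡ; //-rightDividesʳ)
  open import Relation.Binary.Reasoning.Setoid setoid
  open Conjugation G

  infix 4 _~_
  _~_ : List Carrier → List Carrier → Set _
  _~_ = HurwitzEquiv G

  ≡⇒~ : ∀ {xs ys} → xs ≡ ys → xs ~ ys
  ≡⇒~ ≡.refl = Star.ε

  ≈⇒~ : ∀ {xs ys} → Pointwise _≈_ xs ys → xs ~ ys
  ≈⇒~ xs≈ys = inj₂ xs≈ys ◅ Star.ε

  step⇒~ : ∀ {xs ys} → HurwitzStep G xs ys → xs ~ ys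
  step⇒~ s = inj₁ s ◅ Star.ε

  ++⁺ˡ : ∀ zs {xs ys} → xs ~ ys → zs ++ xs ~ zs ++ ys
  ++⁺ˡ []       xs~ys = xs~ys
  ++⁺ˡ (z ∷ zs) xs~ys = Star.gmap (z ∷_) ∷⁺ (++⁺ˡ zs xs~ys)
    where
    ∷⁺ : ∀ {xs ys} → HurwitzStep G xs ys ⊎ Pointwise _≈_ xs ys
       → HurwitzStep G (z ∷ xs) (z ∷ ys) ⊎ Pointwise _≈_ (z ∷ xs) (z ∷ ys)
    ∷⁺ (inj₁ s)     = inj₁ (HurwitzStep.there s)
    ∷⁺ (inj₂ xs≈ys) = inj₂ (refl ∷ xs≈ys)

  step-reverse : ∀ {xs ys} → HurwitzStep G xs ys → ys ~ xs
  step-reverse (σ {a} {b}) = step⇒~ σ⁻¹ ◅◅ ≈⇒~ (σ⁻¹σ≈id ∷ refl ∷ Pointwise.refl refl)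
    where
    σ⁻¹σ≈id : (b ∙ ((b ⁻¹ ∙ a) ∙ b)) ∙ b ⁻¹ ≈ a
    σ⁻¹σ≈id = begin
      (b ∙ ((b ⁻¹ ∙ a) ∙ b)) ∙ b ⁻¹ ≈⟨ ∙-congʳ (assoc _ _ _) ⟨
      ((b ∙ (b ⁻¹ ∙ a)) ∙ b) ∙ b ⁻¹ ≈⟨ //-rightDividesʳ b _ ⟩
      b ∙ (b ⁻¹ ∙ a)                ≈⟨ \\-leftDividesˡ b a ⟩
      a                             ∎
  step-reverse (σ⁻¹ {a} {b}) = step⇒~ σ ◅◅ ≈⇒~ (refl ∷ σσ⁻¹≈id ∷ Pointwise.refl refl)
    where
    σσ⁻¹≈id : (a ⁻¹ ∙ ((a ∙ b) ∙ a ⁻¹)) ∙ a ≈ b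
    σσ⁻¹≈id = begin
      (a ⁻¹ ∙ ((a ∙ b) ∙ a ⁻¹)) ∙ a ≈⟨ ∙-congʳ (assoc _ _ _) ⟨
      ((a ⁻¹ ∙ (a ∙ b)) ∙ a ⁻¹) ∙ a ≈⟨ //-rightDividesˡ a _ ⟩
      a ⁻¹ ∙ (a ∙ b)                ≈⟨ \\-leftDividesʳ a b ⟩
      b                             ∎
  step-reverse (there {f} s) = ++⁺ˡ [ f ] (step-reverse s)

  ~-sym : ∀ {xs ys} → xs ~ ys → ys ~ xs
  ~-sym Star.ε               = Star.ε
  ~-sym (inj₁ s ◅ xs~ys)     = ~-sym xs~ys ◅◅ step-reverse s
  ~-sym (inj₂ xs≈ys ◅ xs~ys) = ~-sym xs~ys ◅◅ ≈⇒~ (Pointwise.symmetric sym xs≈ys)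

  sweep-σ : ∀ f g rest → f ++ g ∷ rest ~ g ∷ List.map (_^ g) f ++ rest
  sweep-σ []      g rest = Star.ε
  sweep-σ (a ∷ f) g rest = ++⁺ˡ [ a ] (sweep-σ f g rest) ◅◅ step⇒~ σ

  sweep-σ⁻¹ : ∀ f g rest → ∃ λ h → h ∙ prod G f ≈ prod G f ∙ g × f ++ g ∷ rest ~ h ∷ f ++ rest
  sweep-σ⁻¹ []      g rest = g , trans (identityʳ g) (sym (identityˡ g)) , Star.ε
  sweep-σ⁻¹ (a ∷ f) g rest
    with h , h∙p≈p∙g , moves ← sweep-σ⁻¹ f g rest
    = (a ∙ h) ∙ a ⁻¹ , h′∙ap≈ap∙g , ++⁺ˡ [ a ] moves ◅◅ step⇒~ σ⁻¹
    where
    p : Carrier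
    p = prod G f
    h′∙ap≈ap∙g : ((a ∙ h) ∙ a ⁻¹) ∙ (a ∙ p) ≈ (a ∙ p) ∙ g
    h′∙ap≈ap∙g = begin
      ((a ∙ h) ∙ a ⁻¹) ∙ (a ∙ p) ≈⟨ assoc _ _ _ ⟩
      (a ∙ h) ∙ (a ⁻¹ ∙ (a ∙ p)) ≈⟨ ∙-congˡ (\\-leftDividesʳ a p) ⟩
      (a ∙ h) ∙ p                ≈⟨ assoc _ _ _ ⟩
      a ∙ (h ∙ p)                ≈⟨ ∙-congˡ h∙p≈p∙g ⟩
      a ∙ (p ∙ g)                ≈⟨ assoc _ _ _ ⟨
      (a ∙ p) ∙ g                ∎

  trivial-block-commutes : ∀ f → prod G f ≈ ε → ∀ zs rest → f ++ zs ++ rest ~ zs ++ f ++ rest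
  trivial-block-commutes f Πf≈ε []      rest = Star.ε
  trivial-block-commutes f Πf≈ε (g ∷ zs) rest
    with h , h∙p≈p∙g , moves ← sweep-σ⁻¹ f g (zs ++ rest)
    = moves ◅◅ ≈⇒~ (h≈g ∷ Pointwise.refl refl)
            ◅◅ ++⁺ˡ [ g ] (trivial-block-commutes f Πf≈ε zs rest)
    where
    h≈g : h ≈ g
    h≈g = begin
      h            ≈⟨ identityʳ h ⟨
      h ∙ ε        ≈⟨ ∙-congˡ Πf≈ε ⟨
      h ∙ prod G f ≈⟨ h∙p≈p∙g ⟩
      prod G f ∙ g ≈⟨ ∙-congʳ Πf≈ε ⟩
      ε ∙ g        ≈⟨ identityˡ g ⟩
      g            ∎

  trivial-block-conj : ∀ f → prod G f ≈ ε → ∀ {g zs} → g ∈ zs → f ++ zs ~ List.map (_^ g) f ++ zs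
  trivial-block-conj f Πf≈ε {g} g∈zs with A , B , ≡.refl ← ∈-∃++ g∈zs =
    trivial-block-commutes f Πf≈ε A (g ∷ B)
    ◅◅ ++⁺ˡ A (sweep-σ f g B)
    ◅◅ ≡⇒~ (≡.sym (++-assoc A [ g ] (fᵍ ++ B)))
    ◅◅ ~-sym (trivial-block-commutes fᵍ Πfᵍ≈ε (A ++ [ g ]) B)
    ◅◅ ≡⇒~ (≡.cong (fᵍ ++_) (++-assoc A [ g ] B))
    where
    fᵍ : List Carrier
    fᵍ = List.map (_^ g) f
    Πfᵍ≈ε : prod G fᵍ ≈ ε
    Πfᵍ≈ε = trans (prod-map-^ f g) (trans (^-congˡ g Πf≈ε) (ε^g≈ε g))

module DirectProduct {c₁ ℓ₁ c₂ ℓ₂ : Level} (G₁ : Group c₁ ℓ₁) (G₂ : Group c₂ ℓ₂) where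
  private
    module G₁ = Group G₁
    module G₂ = Group G₂
  open Group (group G₁ G₂)

  ι₁ : G₁.Carrier → Carrier
  ι₁ r = r , G₂.ε

  prod-ι₁ : ∀ {n} (R : Vec G₁.Carrier n) → prod (group G₁ G₂) (toList (map ι₁ R)) ≈ ι₁ (prod G₁ (toList R))
  prod-ι₁ Vec.[]      = refl
  prod-ι₁ (r Vec.∷ R) = trans (∙-congˡ (prod-ι₁ R)) (G₁.refl , G₂.identityˡ G₂.ε)

  map-ι₁-^ : ∀ {n} (R : Vec G₁.Carrier n) a x →
    Pointwise _≈_ (List.map (λ q → conj (group G₁ G₂) q (a , x)) (toList (map ι₁ R)))
                  (toList (map ι₁ (map (λ r → conj G₁ r a) R)))
  map-ι₁-^ Vec.[]      a x = []
  map-ι₁-^ (r Vec.∷ R) a x = (G₁.refl , Conjugation.ε^g≈ε G₂ x) ∷ map-ι₁-^ R a x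

lemma3p3 : {c₁ ℓ₁ c₂ ℓ₂ : Level} (G₁ : Group c₁ ℓ₁) (G₂ : Group c₂ ℓ₂)
    → (n m : ℕ) (R : Vec (Group.Carrier G₁) n) (W : Vec (Group.Carrier G₁) m)
    → (H : Group.Carrier G₁) (X : Vec (Group.Carrier G₂) (m + 2))
    → Group._≈_ G₁ (prod G₁ (toList R)) (Group.ε G₁)
    → (j : Fin m)
    → HurwitzEquiv (group G₁ G₂) (P G₁ G₂ W X R H)
    (P G₁ G₂ W X (map (λ r → conj G₁ r (lookup W j)) R) H)
lemma3p3 G₁ G₂ n m R W H X ΠR≈ε j =
  trivial-block-conj (toList (map ι₁ R)) (trans (prod-ι₁ R) (ΠR≈ε , G₂.refl))
    (∈-++⁺ˡ (≡.subst (_∈ toList WX) (lookup-zipWith _,_ j W (Vec.take m X))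
                     (∈-toList⁺ (∈-lookup j WX))))
  ◅◅ ≈⇒~ (Pointwise.++⁺ (map-ι₁-^ R (lookup W j) (lookup (Vec.take m X) j)) (Pointwise.refl refl))
  where
  module G₂ = Group G₂
  open Group (group G₁ G₂) using (refl; trans)
  open HurwitzMoves (group G₁ G₂)
  open DirectProduct G₁ G₂
  WX = Vec.zipWith _,_ W (Vec.take m X)
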